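{- If an infinite word $u$ over a finite alphabet has property $R_2$ (every factor has exactly two return words), then $u$ has no maximal right special factor.
   Context: Factors of $u=u_0u_1\cdots$ are finite (possibly empty) words occurring in $u$. For a factor $w$, $\mathcal E_\ell(w)=\{a: aw \text{ is a factor}\}$, $\mathcal E_r(w)=\{b: wb\text{ is a factor}\}$; $w$ is right special if $\#\mathcal E_r(w)\ge2$. A right special factor $w$ is maximal right special if it is not a proper suffix of any right special factor, i.e., $\sum_{a\in\mathcal E_\ell(w)}(\#\mathcal E_r(aw)-1)=0$. If $j<k$ are successive occurrences of $w$ (positions $j$ with $u_j\cdots u_{j+|w|-1}=w$), then $u_j\cdots u_{k-1}$ is a return word of $w$. -}

module Defs where

open import Data.Nat using (ℕ; zero; suc; _+_; _∸_; _<_)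
open import Data.Fin using (Fin)
open import Data.List using (List; []; _∷_; _++_; [_]; length)
open import Data.Product using (Σ; ∃; _×_; _,_)
open import Data.Sum using (_⊎_)
open import Relation.Binary.PropositionalEquality using (_≡_; _≢_)
open import Relation.Nullary using (¬_)

Word : ℕ → Set
Word k = ℕ → Fin k

segment : ∀ {k} → Word k → ℕ → ℕ → List (Fin k)
segment u i zero    = []
segment u i (suc n) = u i ∷ segment u (suc i) n

OccursAt : ∀ {k} → Word k → List (Fin k) → ℕ → Set
OccursAt u w i = segment u i (length w) ≡ w

Factor : ∀ {k} → Word k → List (Fin k) → Set
Factor u w = ∃ λ i → OccursAt u w i

IsReturnWord : ∀ {k} → Word k → List (Fin k) → List (Fin k) → Set
IsReturnWord u w r =
  Σ ℕ λ j → Σ ℕ λ m →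
    j < m × OccursAt u w j × OccursAt u w m
    × (∀ l → j < l → l < m → ¬ OccursAt u w l)
    × r ≡ segment u j (m ∸ j)

HasExactlyTwoReturnWords : ∀ {k} → Word k → List (Fin k) → Set
HasExactlyTwoReturnWords u w =
  Σ (List _) λ r₁ → Σ (List _) λ r₂ →
    r₁ ≢ r₂ × (∀ r → IsReturnWord u w r → (r ≡ r₁ ⊎ r ≡ r₂))
    × IsReturnWord u w r₁ × IsReturnWord u w r₂

PropertyR₂ : ∀ {k} → Word k → Set
PropertyR₂ u = ∀ w → Factor u w → HasExactlyTwoReturnWords u w

RightSpecial : ∀ {k} → Word k → List (Fin k) → Set
RightSpecial u w =
  Σ _ λ a → Σ _ λ b → a ≢ b × Factor u (w ++ [ a ]) × Factor u (w ++ [ b ])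

MaximalRightSpecial : ∀ {k} → Word k → List (Fin k) → Set
MaximalRightSpecial u w =
  RightSpecial u w × (∀ v → v ≢ [] → ¬ RightSpecial u (v ++ w))

{-# OPTIONS --safe #-}
-- Let w be right special, with w a and w b factors (a ≢ b), such that no x w is right
-- special. Under R₂ every factor recurs, and the two return words r_a, r_b of w are told
-- apart by the letter following the occurrence they start at. As x w is never right
-- special, the letter following an occurrence of w is fixed by the letter preceding it,
-- i.e. by the previous return word; so the letter after one occurrence determines the
-- letter after the next, and since both w a and w b recur these letters must alternate.
-- Hence consecutive occurrences of w a are always r_a r_b apart, and w a has a single
-- return word, contradicting R₂.
module Submission where

open import Defs
open import Data.Nat
  using (ℕ; zero; suc; _+_; _∸_; _<_; _≤_; _≤′_; ≤′-refl; ≤′-step; _<?_; s≤s; z≤n)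
open import Data.Nat.Properties
open import Data.Fin using (Fin)
import Data.Fin.Properties as Fin
open import Data.List using (List; []; _∷_; _++_; [_]; _∷ʳ_; length)
open import Data.List.Properties using (∷-injectiveˡ; ∷-injectiveʳ; length-++; ≡-dec)
open import Data.Product using (∃; ∃₂; _×_; _,_; proj₂)
open import Data.Sum using (_⊎_; inj₁; inj₂)
open import Data.Empty using (⊥)
open import Relation.Binary using (tri<; tri≈; tri>)
open import Relation.Binary.PropositionalEquality hiding ([_])
open import Relation.Nullary using (¬_; yes; no; contradiction)
open import Relation.Unary using (Decidable)

++-injective : ∀ {A : Set} (xs ys : List A) {p q : List A} → length xs ≡ length ys →
               xs ++ p ≡ ys ++ q → xs ≡ ys × p ≡ q
++-injective []       []       _       eq = refl , eq
++-injective []       (_ ∷ _)  ()      _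
++-injective (_ ∷ _)  []       ()      _
++-injective (x ∷ xs) (y ∷ ys) lengths eq =
  let xs≡ys , p≡q = ++-injective xs ys (suc-injective lengths) (∷-injectiveʳ eq)
  in cong₂ _∷_ (∷-injectiveˡ eq) xs≡ys , p≡q

among-two : ∀ {A : Set} {r₁ r₂ x y z : A} →
            (x ≡ r₁ ⊎ x ≡ r₂) → (y ≡ r₁ ⊎ y ≡ r₂) → (z ≡ r₁ ⊎ z ≡ r₂) → y ≢ z →
            x ≡ y ⊎ x ≡ z
among-two (inj₁ x≡r) (inj₁ y≡r) _          _   = inj₁ (trans x≡r (sym y≡r))
among-two (inj₂ x≡r) (inj₂ y≡r) _          _   = inj₁ (trans x≡r (sym y≡r))
among-two (inj₁ x≡r) (inj₂ _)   (inj₁ z≡r) _   = inj₂ (trans x≡r (sym z≡r))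
among-two (inj₂ x≡r) (inj₁ _)   (inj₂ z≡r) _   = inj₂ (trans x≡r (sym z≡r))
among-two (inj₁ _)   (inj₂ y≡r) (inj₂ z≡r) y≢z = contradiction (trans y≡r (sym z≡r)) y≢z
among-two (inj₂ _)   (inj₁ y≡r) (inj₁ z≡r) y≢z = contradiction (trans y≡r (sym z≡r)) y≢z

record Gap (P : ℕ → Set) (j d : ℕ) : Set where
  field
    positive : 0 < d
    start    : P j
    end      : P (j + d)
    skips    : ∀ l → j < l → l < j + d → ¬ P l

module _ {P : ℕ → Set} where

  gap-between : ∀ {j m} → P j → P m → j < m → (∀ l → j < l → l < m → ¬ P l) →
                Gap P j (m ∸ j)
  gap-between {j} {m} pj pm j<m skips = record
    { positive = m<n⇒0<n∸m j<m
    ; start    = pj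
    ; end      = subst P (sym j+[m∸j]≡m) pm
    ; skips    = λ l j<l l<m → skips l j<l (subst (l <_) j+[m∸j]≡m l<m)
    }
    where j+[m∸j]≡m = m+[n∸m]≡n (<⇒≤ j<m)

  gap-unique : ∀ {j d d′} → Gap P j d → Gap P j d′ → d ≡ d′
  gap-unique {j} {d} {d′} g g′ with <-cmp d d′
  ... | tri< d<d′ _ _ = contradiction (Gap.end g)
                          (Gap.skips g′ (j + d) (m<m+n j (Gap.positive g)) (+-monoʳ-< j d<d′))
  ... | tri≈ _ d≡d′ _ = d≡d′
  ... | tri> _ _ d′<d = contradiction (Gap.end g′)
                          (Gap.skips g (j + d′) (m<m+n j (Gap.positive g′)) (+-monoʳ-< j d′<d))

  skips-extend : ∀ {p q} → (∀ l → p < l → l ≤ q → ¬ P l) → ¬ P (suc q) →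
                 ∀ l → p < l → l ≤ suc q → ¬ P l
  skips-extend skips ¬psq l p<l l≤sq with m≤n⇒m<n∨m≡n l≤sq
  ... | inj₁ l<sq  = skips l p<l (≤-pred l<sq)
  ... | inj₂ refl = ¬psq

  module _ (P? : Decidable P) where

    first-after : ∀ {j} → P j → ∀ t → (∀ l → j < l → l ≤ t → ¬ P l) ⊎ ∃ (Gap P j)
    first-after pj zero = inj₁ λ l j<l l≤0 _ → n≮0 (<-≤-trans j<l l≤0)
    first-after {j} pj (suc t) with first-after pj t | j <? suc t | P? (suc t)
    ... | inj₂ gap  | _        | _        = inj₂ gap
    ... | inj₁ none | yes j<st | yes pst =
      inj₂ (_ , gap-between pj pst j<st λ l j<l l<st → none l j<l (≤-pred l<st))
    ... | inj₁ none | yes _    | no ¬pst = inj₁ (skips-extend none ¬pst)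
    ... | inj₁ _    | no j≮st  | _       = inj₁ λ l j<l l≤st _ → j≮st (<-≤-trans j<l l≤st)

    gap-exists : ∀ {j t} → P j → P t → j < t → ∃ (Gap P j)
    gap-exists {t = t} pj pt j<t with first-after pj t
    ... | inj₁ none = contradiction pt (none t j<t ≤-refl)
    ... | inj₂ gap  = gap

    module _ (Q : ℕ → Set) (step : ∀ {p d} → Gap P p d → Q p → Q (p + d))
             {j} (pj : P j) (qj : Q j) where

      last-upTo-satisfies : ∀ {q} → j ≤′ q →
                            ∃ λ p → P p × Q p × p ≤ q × (∀ l → p < l → l ≤ q → ¬ P l)
      last-upTo-satisfies ≤′-refl = j , pj , qj , ≤-refl , λ l j<l l≤j _ → <⇒≱ j<l l≤j
      last-upTo-satisfies (≤′-step {q} j≤′q)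
        with last-upTo-satisfies j≤′q | P? (suc q)
      ... | p , pp , qp , p≤q , none | yes psq =
        suc q , psq , subst Q p+[sq∸p]≡sq (step gap qp) , ≤-refl , λ l sq<l l≤sq _ → <⇒≱ sq<l l≤sq
        where
          gap = gap-between pp psq (s≤s p≤q) λ l p<l l<sq → none l p<l (≤-pred l<sq)
          p+[sq∸p]≡sq = m+[n∸m]≡n (m≤n⇒m≤1+n p≤q)
      ... | p , pp , qp , p≤q , none | no ¬psq = p , pp , qp , m≤n⇒m≤1+n p≤q , skips-extend none ¬psq

      gap-induction : ∀ {q} → j ≤ q → P q → Q q
      gap-induction j≤q pq with last-upTo-satisfies (≤⇒≤′ j≤q)
      ... | p , _ , qp , p≤q , none with m≤n⇒m<n∨m≡n p≤q
      ...   | inj₁ p<q  = contradiction pq (none _ p<q ≤-refl)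
      ...   | inj₂ refl = qp

module _ {k} (u : Word k) where

  length-segment : ∀ i L → length (segment u i L) ≡ L
  length-segment i zero    = refl
  length-segment i (suc L) = cong suc (length-segment (suc i) L)

  segment-++ : ∀ i p r → segment u i (p + r) ≡ segment u i p ++ segment u (i + p) r
  segment-++ i zero    r = cong (λ i′ → segment u i′ r) (sym (+-identityʳ i))
  segment-++ i (suc p) r = cong (u i ∷_) (begin
    segment u (suc i) (p + r)                      ≡⟨ segment-++ (suc i) p r ⟩
    segment u (suc i) p ++ segment u (suc i + p) r ≡⟨ cong (λ i′ → segment u (suc i) p ++ segment u i′ r)
                                                           (sym (+-suc i p)) ⟩
    segment u (suc i) p ++ segment u (i + suc p) r ∎)
    where open ≡-Reasoning

  segment-≡-at : ∀ {i j L t} → segment u i L ≡ segment u j L → t < L → u (i + t) ≡ u (j + t)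
  segment-≡-at {i} {j} {suc L} {zero} eq _
    rewrite +-identityʳ i | +-identityʳ j = ∷-injectiveˡ eq
  segment-≡-at {i} {j} {suc L} {suc t} eq t<L
    rewrite +-suc i t | +-suc j t = segment-≡-at (∷-injectiveʳ eq) (≤-pred t<L)

  segment-drop : ∀ i j p {r} → segment u i (p + r) ≡ segment u j (p + r) →
                 segment u (i + p) r ≡ segment u (j + p) r
  segment-drop i j p {r} eq = proj₂ (++-injective (segment u i p) (segment u j p)
    (trans (length-segment i p) (sym (length-segment j p)))
    (trans (sym (segment-++ i p r)) (trans eq (segment-++ j p r))))

  gap⇒returnWord : ∀ {v j d} → Gap (OccursAt u v) j d → IsReturnWord u v (segment u j d)
  gap⇒returnWord {j = j} {d} g =
    j , j + d , m<m+n j (Gap.positive g) , Gap.start g , Gap.end g , Gap.skips g ,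
    cong (segment u j) (sym (m+n∸m≡n j d))

  returnWord⇒gap : ∀ {v r} → IsReturnWord u v r →
                   ∃₂ λ j d → Gap (OccursAt u v) j d × r ≡ segment u j d
  returnWord⇒gap (j , m , j<m , oj , om , skips , r≡) = j , m ∸ j , gap-between oj om j<m skips , r≡

HasReturnWords : ∀ {k} → Word k → Set
HasReturnWords u = ∀ w → Factor u w → ∃ (IsReturnWord u w)

R₂⇒hasReturnWords : ∀ {k} {u : Word k} → PropertyR₂ u → HasReturnWords u
R₂⇒hasReturnWords R₂ w factor = let r₁ , _ , _ , _ , ret₁ , _ = R₂ w factor in r₁ , ret₁

module _ {k} {u : Word k} (recurrent : HasReturnWords u) where

  occurs-again : ∀ {v i} → OccursAt u v i → ∃ λ l → i < l × OccursAt u v l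
  occurs-again {v} {i} v-at-i
    with recurrent (segment u 0 (i + length v)) (0 , cong (segment u 0) (length-segment u 0 _))
  ... | _ , _ , m , j<m , _ , prefix-at-m , _ =
    m + i , m<n+m i (≤-<-trans z≤n j<m) , trans (segment-drop u m 0 i prefix-at-m′) v-at-i
    where
      prefix-at-m′ : segment u m (i + length v) ≡ segment u 0 (i + length v)
      prefix-at-m′ = subst (λ L → segment u m L ≡ segment u 0 (i + length v)) (length-segment u 0 _) prefix-at-m

  occurs-beyond : ∀ {v i} → OccursAt u v i → ∀ N → ∃ λ l → N ≤ l × OccursAt u v l
  occurs-beyond {i = i} v-at-i zero = i , z≤n , v-at-i
  occurs-beyond v-at-i (suc N) =
    let l , N≤l , v-at-l = occurs-beyond v-at-i N
        l′ , l<l′ , v-at-l′ = occurs-again v-at-l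
    in l′ , ≤-<-trans N≤l l<l′ , v-at-l′

module Occurrences {k} (u : Word k) (w : List (Fin k)) where

  Occ : ℕ → Set
  Occ = OccursAt u w

  occ? : Decidable Occ
  occ? j = ≡-dec Fin._≟_ (segment u j (length w)) w

  after : ℕ → Fin k
  after j = u (j + length w)

  occursAt-∷ʳ⁺ : ∀ {c i} → Occ i → after i ≡ c → OccursAt u (w ∷ʳ c) i
  occursAt-∷ʳ⁺ {c} {i} w-at-i after≡c = begin
    segment u i (length (w ∷ʳ c))          ≡⟨ cong (segment u i) (length-++ w) ⟩
    segment u i (length w + 1)             ≡⟨ segment-++ u i (length w) 1 ⟩
    segment u i (length w) ++ [ after i ]  ≡⟨ cong₂ (λ x y → x ++ [ y ]) w-at-i after≡c ⟩
    w ∷ʳ c                                 ∎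
    where open ≡-Reasoning

  occursAt-∷ʳ⁻ : ∀ {c i} → OccursAt u (w ∷ʳ c) i → Occ i × after i ≡ c
  occursAt-∷ʳ⁻ {c} {i} wc-at-i =
    let w-at-i , [after]≡[c] = ++-injective (segment u i (length w)) w (length-segment u i _)
          (trans (sym (segment-++ u i (length w) 1))
                 (trans (cong (segment u i) (sym (length-++ w))) wc-at-i))
    in w-at-i , ∷-injectiveˡ [after]≡[c]

  returnWord⇒after : ∀ {j j′ d d′} → Gap Occ j d → Gap Occ j′ d′ →
                     segment u j d ≡ segment u j′ d′ → after j ≡ after j′
  returnWord⇒after {j} {j′} {d} {d′} g g′ r≡r′
    with trans (sym (length-segment u j d)) (trans (cong length r≡r′) (length-segment u j′ d′))
  ... | refl = segment-≡-at u (begin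
    segment u j (d + length w)   ≡⟨ extended g ⟩
    segment u j d ++ w           ≡⟨ cong (_++ w) r≡r′ ⟩
    segment u j′ d ++ w          ≡⟨ sym (extended g′) ⟩
    segment u j′ (d + length w)  ∎) (m<n+m (length w) (Gap.positive g))
    where
      open ≡-Reasoning
      extended : ∀ {i} → Gap Occ i d → segment u i (d + length w) ≡ segment u i d ++ w
      extended {i} gap = trans (segment-++ u i d (length w)) (cong (segment u i d ++_) (Gap.end gap))

  gap-∷ʳ : ∀ {c j d₁ d₂} → Gap Occ j d₁ → Gap Occ (j + d₁) d₂ →
           after j ≡ c → after (j + d₁) ≢ c → after (j + d₁ + d₂) ≡ c →
           Gap (OccursAt u (w ∷ʳ c)) j (d₁ + d₂)
  gap-∷ʳ {c} {j} {d₁} {d₂} g₁ g₂ after₀ after₁ after₂ = record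
    { positive = <-≤-trans (Gap.positive g₁) (m≤m+n d₁ d₂)
    ; start    = occursAt-∷ʳ⁺ (Gap.start g₁) after₀
    ; end      = subst (OccursAt u (w ∷ʳ c)) (+-assoc j d₁ d₂) (occursAt-∷ʳ⁺ (Gap.end g₂) after₂)
    ; skips    = skips
    }
    where
      skips : ∀ l → j < l → l < j + (d₁ + d₂) → ¬ OccursAt u (w ∷ʳ c) l
      skips l j<l l<end wc-at-l with occursAt-∷ʳ⁻ wc-at-l | <-cmp l (j + d₁)
      ... | w-at-l , _       | tri< l<mid _ _ = Gap.skips g₁ l j<l l<mid w-at-l
      ... | _      , after-l | tri≈ _ refl _  = after₁ after-l
      ... | w-at-l , _       | tri> _ _ mid<l =
        Gap.skips g₂ l mid<l (subst (l <_) (sym (+-assoc j d₁ d₂)) l<end) w-at-l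

module NoMaximalRightSpecial {k} {u : Word k} (R₂ : PropertyR₂ u) {w : List (Fin k)}
                             (¬special : ∀ x → ¬ RightSpecial u (x ∷ w)) where
  open Occurrences u w

  recurrent : HasReturnWords u
  recurrent = R₂⇒hasReturnWords R₂

  next-occurrence : ∀ {j} → Occ j → ∃ (Gap Occ j)
  next-occurrence w-at-j =
    let l , j<l , w-at-l = occurs-again recurrent w-at-j in gap-exists occ? w-at-j w-at-l j<l

  same-preceding⇒same-after : ∀ {p p′} → Occ (suc p) → Occ (suc p′) →
                              u p ≡ u p′ → after (suc p) ≡ after (suc p′)
  same-preceding⇒same-after {p} {p′} w-at-sp w-at-sp′ up≡up′
    with after (suc p) Fin.≟ after (suc p′)
  ... | yes same  = same
  ... | no differ = contradiction (after (suc p) , after (suc p′) , differ ,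
          (p  , cong (u p ∷_) (occursAt-∷ʳ⁺ w-at-sp refl)) ,
          (p′ , cong₂ _∷_ (sym up≡up′) (occursAt-∷ʳ⁺ w-at-sp′ refl))) (¬special (u p))

  returnWord⇒next-after : ∀ {j j′ d} → Gap Occ j d → Gap Occ j′ d →
                          segment u j d ≡ segment u j′ d → after (j + d) ≡ after (j′ + d)
  returnWord⇒next-after {d = zero} g = contradiction (Gap.positive g) n≮0
  returnWord⇒next-after {j} {j′} {suc e} g g′ r≡r′ =
    subst₂ (λ q q′ → after q ≡ after q′) (sym (+-suc j e)) (sym (+-suc j′ e))
      (same-preceding⇒same-after (subst Occ (+-suc j e) (Gap.end g))
                                 (subst Occ (+-suc j′ e) (Gap.end g′))
                                 (segment-≡-at u r≡r′ ≤-refl))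

  module TwoExtensions {a b ia ib da db} (a≢b : a ≢ b)
                       (gap-a : Gap Occ ia da) (after-ia : after ia ≡ a)
                       (gap-b : Gap Occ ib db) (after-ib : after ib ≡ b) where

    ra rb : List (Fin k)
    ra = segment u ia da
    rb = segment u ib db

    ra≢rb : ra ≢ rb
    ra≢rb ra≡rb = a≢b (trans (sym after-ia) (trans (returnWord⇒after gap-a gap-b ra≡rb) after-ib))

    returnWord-cases : ∀ {j d} → Gap Occ j d →
                       (after j ≡ a × segment u j d ≡ ra) ⊎ (after j ≡ b × segment u j d ≡ rb)
    returnWord-cases g with R₂ w (ia , Gap.start gap-a)
    ... | _ , _ , _ , only , _
      with among-two (only _ (gap⇒returnWord u g)) (only _ (gap⇒returnWord u gap-a))
                     (only _ (gap⇒returnWord u gap-b)) ra≢rb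
    ... | inj₁ r≡ra = inj₁ (trans (returnWord⇒after g gap-a r≡ra) after-ia , r≡ra)
    ... | inj₂ r≡rb = inj₂ (trans (returnWord⇒after g gap-b r≡rb) after-ib , r≡rb)

    after-cases : ∀ {j} → Occ j → after j ≡ a ⊎ after j ≡ b
    after-cases w-at-j with returnWord-cases (proj₂ (next-occurrence w-at-j))
    ... | inj₁ (after≡a , _) = inj₁ after≡a
    ... | inj₂ (after≡b , _) = inj₂ after≡b

    after⇒returnWord : ∀ {j j′ d d′} → Gap Occ j d → Gap Occ j′ d′ →
                       after j ≡ after j′ → segment u j d ≡ segment u j′ d′
    after⇒returnWord g g′ same with returnWord-cases g | returnWord-cases g′
    ... | inj₁ (_ , r≡ra)    | inj₁ (_ , r′≡ra)    = trans r≡ra (sym r′≡ra)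
    ... | inj₂ (_ , r≡rb)    | inj₂ (_ , r′≡rb)    = trans r≡rb (sym r′≡rb)
    ... | inj₁ (after≡a , _) | inj₂ (after′≡b , _) =
      contradiction (trans (sym after≡a) (trans same after′≡b)) a≢b
    ... | inj₂ (after≡b , _) | inj₁ (after′≡a , _) =
      contradiction (trans (sym after′≡a) (trans (sym same) after≡b)) a≢b

    after⇒next-after : ∀ {j j′ d d′} → Gap Occ j d → Gap Occ j′ d′ →
                       after j ≡ after j′ → after (j + d) ≡ after (j′ + d′)
    after⇒next-after {j} {j′} {d} {d′} g g′ same with after⇒returnWord g g′ same
    ... | r≡r′
      with trans (sym (length-segment u j d)) (trans (cong length r≡r′) (length-segment u j′ d′))
    ... | refl = returnWord⇒next-after g g′ r≡r′

    after-alternates : ∀ {j d} → Gap Occ j d → after (j + d) ≢ after j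
    after-alternates {j} g repeats =
      a≢b (trans (occurring⇒after (occursAt-∷ʳ⁺ (Gap.start gap-a) after-ia))
           (sym (occurring⇒after (occursAt-∷ʳ⁺ (Gap.start gap-b) after-ib))))
      where
        stable : ∀ {q} → j ≤ q → Occ q → after q ≡ after j
        stable = gap-induction occ? (λ q → after q ≡ after j)
                   (λ g′ same → trans (after⇒next-after g′ g same) repeats) (Gap.start g) refl
        occurring⇒after : ∀ {c i} → OccursAt u (w ∷ʳ c) i → c ≡ after j
        occurring⇒after wc-at-i =
          let l , j≤l , wc-at-l = occurs-beyond recurrent wc-at-i j
              w-at-l , after-l = occursAt-∷ʳ⁻ wc-at-l
          in trans (sym after-l) (stable j≤l w-at-l)

    a⇒next-b : ∀ {j d} → Gap Occ j d → after j ≡ a → after (j + d) ≡ b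
    a⇒next-b g after≡a with after-cases (Gap.end g)
    ... | inj₁ next≡a = contradiction (trans next≡a (sym after≡a)) (after-alternates g)
    ... | inj₂ next≡b = next≡b

    b⇒next-a : ∀ {j d} → Gap Occ j d → after j ≡ b → after (j + d) ≡ a
    b⇒next-a g after≡b with after-cases (Gap.end g)
    ... | inj₁ next≡a = next≡a
    ... | inj₂ next≡b = contradiction (trans next≡b (sym after≡b)) (after-alternates g)

    gap-∷ʳa : ∀ {j} → OccursAt u (w ∷ʳ a) j →
              ∃ λ D → Gap (OccursAt u (w ∷ʳ a)) j D × segment u j D ≡ ra ++ rb
    gap-∷ʳa {j} wa-at-j =
      let w-at-j , after₀ = occursAt-∷ʳ⁻ wa-at-j
          d₁ , g₁ = next-occurrence w-at-j
          d₂ , g₂ = next-occurrence (Gap.end g₁)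
      in d₁ + d₂ , cycle g₁ g₂ after₀
      where
        cycle : ∀ {d₁ d₂} → Gap Occ j d₁ → Gap Occ (j + d₁) d₂ → after j ≡ a →
                Gap (OccursAt u (w ∷ʳ a)) j (d₁ + d₂) × segment u j (d₁ + d₂) ≡ ra ++ rb
        cycle {d₁} {d₂} g₁ g₂ after₀ =
          gap-∷ʳ {c = a} g₁ g₂ after₀ (λ after₁≡a → a≢b (trans (sym after₁≡a) after₁)) after₂ ,
          (begin
            segment u j (d₁ + d₂)                   ≡⟨ segment-++ u j d₁ d₂ ⟩
            segment u j d₁ ++ segment u (j + d₁) d₂
              ≡⟨ cong₂ _++_ (after⇒returnWord g₁ gap-a (trans after₀ (sym after-ia)))
                            (after⇒returnWord g₂ gap-b (trans after₁ (sym after-ib))) ⟩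
            ra ++ rb                                ∎)
          where
            open ≡-Reasoning
            after₁ : after (j + d₁) ≡ b
            after₁ = a⇒next-b g₁ after₀
            after₂ : after (j + d₁ + d₂) ≡ a
            after₂ = b⇒next-a g₂ after₁

    returnWord-∷ʳa : ∀ {r} → IsReturnWord u (w ∷ʳ a) r → r ≡ ra ++ rb
    returnWord-∷ʳa ret =
      let j , d , g , r≡ = returnWord⇒gap u {v = w ∷ʳ a} ret
          D , G , segment≡ = gap-∷ʳa (Gap.start g)
          d≡D = gap-unique {P = OccursAt u (w ∷ʳ a)} g G
      in trans r≡ (trans (cong (segment u j) d≡D) segment≡)

    absurd : ⊥
    absurd =
      let wa-at-ia = occursAt-∷ʳ⁺ (Gap.start gap-a) after-ia
          _ , _ , r₁≢r₂ , _ , ret₁ , ret₂ = R₂ (w ∷ʳ a) (ia , wa-at-ia)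
      in r₁≢r₂ (trans (returnWord-∷ʳa ret₁) (sym (returnWord-∷ʳa ret₂)))

  ¬rightSpecial : ¬ RightSpecial u w
  ¬rightSpecial (a , b , a≢b , (ia , wa-at-ia) , (ib , wb-at-ib)) =
    let w-at-ia , after-ia = occursAt-∷ʳ⁻ wa-at-ia
        w-at-ib , after-ib = occursAt-∷ʳ⁻ wb-at-ib
    in TwoExtensions.absurd a≢b (proj₂ (next-occurrence w-at-ia)) after-ia
                                (proj₂ (next-occurrence w-at-ib)) after-ib

corollary5p3 : (k : ℕ) (u : Word k) → PropertyR₂ u →
    (w : List (Fin k)) → ¬ MaximalRightSpecial u w
corollary5p3 k u R₂ w (special , maximal) =
  NoMaximalRightSpecial.¬rightSpecial R₂ (λ x → maximal [ x ] λ ()) special
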